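{- Let $(a_n)_{n\ge 0}$ be a sequence of real numbers with $a_0=1$, let $F(t)=1+\sum_{n\ge1}a_n\frac{t^n}{n!}$, and for every real $\alpha$ define polynomials $f_n^{(\alpha)}(x)$ by $\sum_{n\ge0}f_n^{(\alpha)}(x)\frac{t^n}{n!}=(F(t))^{\alpha}e^{xt}$. Then for all real numbers $\alpha,\beta,q,x,y$ and every non-negative integer $n$, $$f_n^{(\alpha+\beta)}(x+y)=\sum_{k=0}^{n}\binom{n}{k}\Big(f_k^{(\alpha)}(x-qk)+qk\,f_{k-1}^{(\alpha)}(x-qk)\Big)f_{n-k}^{(\beta)}(y+qk),$$ where the term $qk\,f_{k-1}^{(\alpha)}(x-qk)$ is interpreted as $0$ when $k=0$.
   Context: Here $(F(t))^\alpha=\exp(\alpha\log F(t))$ as a formal power series (well defined since $F(0)=1$). -}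

module Defs where

open import Data.Nat as ℕ using (ℕ; zero; suc; _!)
open import Data.Nat.Combinatorics using (_C_)
open import Data.Product using (Σ; _×_; _,_)
open import Data.Sum using (_⊎_; inj₁; inj₂)
open import Relation.Nullary using (¬_)
open import Relation.Binary.PropositionalEquality
  using (_≡_; _≢_; refl; sym; trans; subst; cong)

-- The real numbers, axiomatised as a Dedekind-complete ordered field
-- (any two such structures are isomorphic, so quantifying over all of
-- them is the same as speaking about ℝ).

record RealField : Set₁ where
  infixl 6 _+_
  infixl 7 _*_
  infix  4 _<_
  infix  8 -_
  field
    R    : Set
    0# 1# : R
    _+_ _*_ : R → R → R
    -_   : R → R
    _<_  : R → R → Set
    inv  : (x : R) → x ≢ 0# → R
    +-assoc    : ∀ x y z → (x + y) + z ≡ x + (y + z)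
    +-comm     : ∀ x y → x + y ≡ y + x
    +-identityʳ : ∀ x → x + 0# ≡ x
    +-inverseʳ : ∀ x → x + (- x) ≡ 0#
    *-assoc    : ∀ x y z → (x * y) * z ≡ x * (y * z)
    *-comm     : ∀ x y → x * y ≡ y * x
    *-identityʳ : ∀ x → x * 1# ≡ x
    distribˡ   : ∀ x y z → x * (y + z) ≡ x * y + x * z
    inv-correct : ∀ x (p : x ≢ 0#) → x * inv x p ≡ 1#
    0≢1        : 0# ≢ 1#
    <-irrefl   : ∀ x → ¬ (x < x)
    <-trans    : ∀ x y z → x < y → y < z → x < z
    <-trichot  : ∀ x y → (x < y) ⊎ ((x ≡ y) ⊎ (y < x))
    +-mono-<   : ∀ x y z → x < y → x + z < y + z
    *-pos      : ∀ x y → 0# < x → 0# < y → 0# < x * y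
    0<1        : 0# < 1#
    complete   : (P : R → Set) → Σ R P →
                 Σ R (λ b → ∀ x → P x → ¬ (b < x)) →
                 Σ R (λ s → (∀ x → P x → ¬ (s < x)) ×
                            (∀ b → (∀ x → P x → ¬ (b < x)) → ¬ (b < s)))

module RealDefs (ℝ : RealField) where
  open RealField ℝ

  _-_ : R → R → R
  x - y = x + (- y)
  infixl 6 _-_

  fromℕ : ℕ → R
  fromℕ zero    = 0#
  fromℕ (suc n) = 1# + fromℕ n

  private
    pos : ∀ n → 0# < fromℕ (suc n)
    pos zero = subst (0# <_) (sym (+-identityʳ 1#)) 0<1
    pos (suc n) =
      <-trans 0# 1# (1# + fromℕ (suc n)) 0<1
        (subst₂ (pos n))
      where
        -- 0 + 1 < fromℕ (suc n) + 1, rewritten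
        subst₂ : 0# < fromℕ (suc n) → 1# < 1# + fromℕ (suc n)
        subst₂ p =
          subst (_< 1# + fromℕ (suc n))
                (trans (+-comm 0# 1#) (+-identityʳ 1#))
                (subst (0# + 1# <_) (+-comm (fromℕ (suc n)) 1#)
                       (+-mono-< 0# (fromℕ (suc n)) 1# p))

  fromℕ-suc≢0 : ∀ n → fromℕ (suc n) ≢ 0#
  fromℕ-suc≢0 n eq = <-irrefl 0# (subst (0# <_) eq (pos n))

  -- reciprocal of a natural number (only used at positive arguments;
  -- the value at 0 is an irrelevant convention)
  invℕ : ℕ → R
  invℕ zero    = 0#
  invℕ (suc n) = inv (fromℕ (suc n)) (fromℕ-suc≢0 n)

  _^_ : R → ℕ → R
  x ^ zero  = 1#
  x ^ suc n = x * (x ^ n)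

  sumTo : ℕ → (ℕ → R) → R
  sumTo zero    g = g 0
  sumTo (suc n) g = sumTo n g + g (suc n)

  -- Formal power series over ℝ: f n is the coefficient of t^n.
  PS : Set
  PS = ℕ → R

  onePS : PS
  onePS zero    = 1#
  onePS (suc _) = 0#

  _⊕_ : PS → PS → PS
  (f ⊕ g) n = f n + g n

  _·_ : R → PS → PS
  (c · f) n = c * f n

  _⊛_ : PS → PS → PS
  (f ⊛ g) n = sumTo n (λ k → f k * g (n ℕ.∸ k))

  powPS : PS → ℕ → PS
  powPS f zero    = onePS
  powPS f (suc m) = f ⊛ powPS f m

  -- log F = Σ_{m≥1} (-1)^{m+1} (F-1)^m / m   (for F(0) = 1).
  -- The coefficient of t^n only receives contributions from m ≤ n.
  logPS : PS → PS
  logPS F n =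
    sumTo n (λ m → ((- 1#) ^ (suc m)) * invℕ m * powPS (F ⊕ ((- 1#) · onePS)) m n)
  -- the m = 0 term vanishes since invℕ 0 = 0 (the sum starts at m = 1)

  -- exp G = Σ_{m≥0} G^m / m!   (for G(0) = 0)
  expPS : PS → PS
  expPS G n = sumTo n (λ m → invℕ (m !) * powPS G m n)

  powαPS : PS → R → PS
  powαPS F α = expPS (α · logPS F)

  expLin : R → PS
  expLin x n = (x ^ n) * invℕ (n !)

  egf : (ℕ → R) → PS
  egf a zero    = 1#
  egf a (suc n) = a (suc n) * invℕ (suc n !)

  fpoly : (ℕ → R) → R → ℕ → R → R
  fpoly a α n x = fromℕ (n !) * (powαPS (egf a) α ⊛ expLin x) n

  bracket : (ℕ → R) → R → R → R → ℕ → R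
  bracket a α q x zero    = fpoly a α 0 (x - q * fromℕ 0)
  bracket a α q x (suc j) =
    fpoly a α (suc j) (x - q * fromℕ (suc j)) +
    q * fromℕ (suc j) * fpoly a α j (x - q * fromℕ (suc j))

{-# OPTIONS --safe #-}
module Submission where

-- Write F^α = exp(α L) with L = log F; as L has no constant term, F^(α+β) = F^α F^β, so
-- f^(α+β)_n(x+y) = n! [t^n] F^α F^β e^((x+y)t).  On the right-hand side write
-- e^((y+qk)t) = e^((x+y)t) e^(-(x-qk)t); after exchanging the sums it remains to show, for every
-- power series A,
--   Σ_{k≤N} [t^k] (1+qt) A(t) e^((x-qk)t) · [t^(N-k)] e^(-(x-qk)t) = [t^N] A.
-- Splitting off A (with x replaced by x - qi) reduces this to A = 1, where the k-th term is
-- x/N! · C(N,k) (-1)^(N-k) (x-qk)^(N-1): the sum is an N-th finite difference of a polynomial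
-- of degree N-1 in k, hence 0 for N ≥ 1.

open import Defs
open import Data.Nat as ℕ using (ℕ; zero; suc; _∸_; _!; z≤n; s≤s)
import Data.Nat.Properties as ℕₚ
open import Data.Nat.Combinatorics
  using (_C_; nCk≡n!/k![n-k]!; k![n∸k]!∣n!; k>n⇒nCk≡0)
open import Data.Nat.DivMod using (m/n*n≡m)
open import Data.Integer as ℤ using (ℤ; -[1+_]; _⊖_)
import Data.Integer.Properties as ℤₚ
open import Data.Sign as Sign using (Sign)
open import Data.Maybe using (Maybe; just; nothing)
open import Data.Product using (_,_)
open import Relation.Nullary using (yes; no)
open import Relation.Binary.PropositionalEquality
open import Algebra.Bundles using (CommutativeRing)
open import Algebra.Consequences.Propositional
  using (comm∧idʳ⇒id; comm∧invʳ⇒inv; comm∧distrˡ⇒distrʳ)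
open import Algebra.Solver.Ring.AlmostCommutativeRing
  using (fromCommutativeRing; _-Raw-AlmostCommutative⟶_)
import Algebra.Solver.Ring


nCk*[k!*[n∸k]!]≡n! : ∀ {n k} → k ℕ.≤ n → (n C k) ℕ.* (k ! ℕ.* (n ∸ k) !) ≡ n !
nCk*[k!*[n∸k]!]≡n! {n} {k} k≤n =
  trans (cong (ℕ._* (k ! ℕ.* (n ∸ k) !)) (nCk≡n!/k![n-k]! k≤n)) (m/n*n≡m (k![n∸k]!∣n! k≤n))
  where instance _ = k ℕₚ.!* (n ∸ k) !≢0

[1+k]*[1+n]C[1+k]≡[1+n]*nCk : ∀ n k → suc k ℕ.* (suc n C suc k) ≡ suc n ℕ.* (n C k)
[1+k]*[1+n]C[1+k]≡[1+n]*nCk n k with k ℕ.≤? n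
... | no k≰n
  rewrite k>n⇒nCk≡0 (ℕₚ.≰⇒> k≰n) | k>n⇒nCk≡0 (s≤s (ℕₚ.≰⇒> k≰n))
        | ℕₚ.*-zeroʳ k | ℕₚ.*-zeroʳ n = refl
... | yes k≤n = ℕₚ.*-cancelʳ-≡ _ _ (k ! ℕ.* (n ∸ k) !) (begin
  suc k ℕ.* (suc n C suc k) ℕ.* (k ! ℕ.* (n ∸ k) !)   ≡⟨ solve 4 (λ a b c d → a :* b :* (c :* d) := b :* (a :* c :* d))
                                                        refl (suc k) (suc n C suc k) (k !) ((n ∸ k) !) ⟩
  (suc n C suc k) ℕ.* (suc k ! ℕ.* (suc n ∸ suc k) !) ≡⟨ nCk*[k!*[n∸k]!]≡n! (s≤s k≤n) ⟩
  suc n ℕ.* n !                                        ≡⟨ cong (suc n ℕ.*_) (nCk*[k!*[n∸k]!]≡n! k≤n) ⟨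
  suc n ℕ.* ((n C k) ℕ.* (k ! ℕ.* (n ∸ k) !))          ≡⟨ ℕₚ.*-assoc (suc n) (n C k) _ ⟨
  suc n ℕ.* (n C k) ℕ.* (k ! ℕ.* (n ∸ k) !)            ∎)
  where
  open ≡-Reasoning
  open import Data.Nat.Solver using (module +-*-Solver)
  open +-*-Solver using (solve; _:*_; _:=_)
  instance _ = k ℕₚ.!* (n ∸ k) !≢0
module RingOfReals (ℝ : RealField) where
  open RealField ℝ

  commutativeRing : CommutativeRing _ _
  commutativeRing = record
    { isCommutativeRing = record
      { isRing = record
        { +-isAbelianGroup = record
          { isGroup = record
            { isMonoid = record
              { isSemigroup = record
                { isMagma = record { isEquivalence = isEquivalence ; ∙-cong = cong₂ _+_ }
                ; assoc = +-assoc }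
              ; identity = comm∧idʳ⇒id +-comm +-identityʳ }
            ; inverse = comm∧invʳ⇒inv +-comm +-inverseʳ
            ; ⁻¹-cong = cong -_ }
          ; comm = +-comm }
        ; *-cong = cong₂ _*_
        ; *-assoc = *-assoc
        ; *-identity = comm∧idʳ⇒id *-comm *-identityʳ
        ; distrib = distribˡ , comm∧distrˡ⇒distrʳ *-comm distribˡ }
      ; *-comm = *-comm } }

  open CommutativeRing commutativeRing public
    using (+-identityˡ; *-identityˡ; distribʳ; zeroˡ; zeroʳ)

  open CommutativeRing commutativeRing using (semiring; ring; +-abelianGroup)
  open import Algebra.Properties.Semiring.Mult.TCOptimised semiring
    using (_×_; ×-homo-+; ×1-homo-*)
  open import Algebra.Properties.Ring ring
    using (-‿involutive; -0#≈0#; -‿distribˡ-*; -‿distribʳ-*)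
  open import Algebra.Properties.AbelianGroup +-abelianGroup using (⁻¹-∙-comm)

  -- The optimised multiple n × 1# is 0# and 1# at n = 0, 1 on the nose, so
  -- the integer coefficients of solver equations evaluate to 0# and 1#.
  fromℤ : ℤ → R
  fromℤ (ℤ.+ n)   = n × 1#
  fromℤ -[1+ n ] = - (suc n × 1#)

  applySign : Sign → R → R
  applySign Sign.+ x = x
  applySign Sign.- x = - x

  applySign-* : ∀ s t x y → applySign (s Sign.* t) (x * y) ≡ applySign s x * applySign t y
  applySign-* Sign.+ Sign.+ x y = refl
  applySign-* Sign.+ Sign.- x y = -‿distribʳ-* x y
  applySign-* Sign.- Sign.+ x y = -‿distribˡ-* x y
  applySign-* Sign.- Sign.- x y = begin
    x * y           ≡⟨ -‿involutive (x * y) ⟨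
    - - (x * y)     ≡⟨ cong -_ (-‿distribʳ-* x y) ⟩
    - (x * - y)     ≡⟨ -‿distribˡ-* x (- y) ⟩
    - x * - y       ∎
    where open ≡-Reasoning

  fromℤ-◃ : ∀ s n → fromℤ (s ℤ.◃ n) ≡ applySign s (n × 1#)
  fromℤ-◃ Sign.+ zero    = refl
  fromℤ-◃ Sign.- zero    = sym -0#≈0#
  fromℤ-◃ Sign.+ (suc n) = refl
  fromℤ-◃ Sign.- (suc n) = refl

  fromℤ-sign : ∀ i → fromℤ i ≡ applySign (ℤ.sign i) (ℤ.∣ i ∣ × 1#)
  fromℤ-sign (ℤ.+ n)   = refl
  fromℤ-sign -[1+ n ] = refl

  suc×1# : ∀ n → suc n × 1# ≡ 1# + n × 1#
  suc×1# = ×-homo-+ 1# 1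

  fromℤ-⊖ : ∀ m n → fromℤ (m ⊖ n) ≡ m × 1# + - (n × 1#)
  fromℤ-⊖ m       zero    = sym (trans (cong (m × 1# +_) -0#≈0#) (+-identityʳ (m × 1#)))
  fromℤ-⊖ zero    (suc n) = sym (+-identityˡ _)
  fromℤ-⊖ (suc m) (suc n) = begin
    fromℤ (suc m ⊖ suc n)           ≡⟨ cong fromℤ (ℤₚ.[1+m]⊖[1+n]≡m⊖n m n) ⟩
    fromℤ (m ⊖ n)                   ≡⟨ fromℤ-⊖ m n ⟩
    a + - b                         ≡⟨ cong (_+ - b) (+-identityˡ a) ⟨
    0# + a + - b                    ≡⟨ cong (λ z → z + a + - b) (+-inverseʳ 1#) ⟨
    1# + - 1# + a + - b             ≡⟨ cong (_+ - b) (+-assoc 1# (- 1#) a) ⟩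
    1# + (- 1# + a) + - b           ≡⟨ cong (λ z → 1# + z + - b) (+-comm (- 1#) a) ⟩
    1# + (a + - 1#) + - b           ≡⟨ cong (_+ - b) (+-assoc 1# a (- 1#)) ⟨
    1# + a + - 1# + - b             ≡⟨ +-assoc (1# + a) (- 1#) (- b) ⟩
    1# + a + (- 1# + - b)           ≡⟨ cong (1# + a +_) (⁻¹-∙-comm 1# b) ⟩
    1# + a + - (1# + b)             ≡⟨ cong₂ (λ u v → u + - v) (suc×1# m) (suc×1# n) ⟨
    suc m × 1# + - (suc n × 1#)     ∎
    where
    open ≡-Reasoning
    a = m × 1#
    b = n × 1#

  fromℤ-+ : ∀ i j → fromℤ (i ℤ.+ j) ≡ fromℤ i + fromℤ j
  fromℤ-+ (ℤ.+ m)   (ℤ.+ n)   = ×-homo-+ 1# m n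
  fromℤ-+ (ℤ.+ m)   -[1+ n ] = fromℤ-⊖ m (suc n)
  fromℤ-+ -[1+ m ] (ℤ.+ n)   = trans (fromℤ-⊖ n (suc m)) (+-comm _ _)
  fromℤ-+ -[1+ m ] -[1+ n ] = begin
    - (suc (suc (m ℕ.+ n)) × 1#)      ≡⟨ cong (λ k → - (suc k × 1#)) (ℕₚ.+-suc m n) ⟨
    - ((suc m ℕ.+ suc n) × 1#)        ≡⟨ cong -_ (×-homo-+ 1# (suc m) (suc n)) ⟩
    - (suc m × 1# + suc n × 1#)       ≡⟨ ⁻¹-∙-comm (suc m × 1#) (suc n × 1#) ⟨
    - (suc m × 1#) + - (suc n × 1#)   ∎
    where open ≡-Reasoning

  fromℤ-* : ∀ i j → fromℤ (i ℤ.* j) ≡ fromℤ i * fromℤ j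
  fromℤ-* i j = begin
    fromℤ (s ℤ.◃ ∣i∣ ℕ.* ∣j∣)                                 ≡⟨ fromℤ-◃ s (∣i∣ ℕ.* ∣j∣) ⟩
    applySign s ((∣i∣ ℕ.* ∣j∣) × 1#)                          ≡⟨ cong (applySign s) (×1-homo-* ∣i∣ ∣j∣) ⟩
    applySign s (∣i∣ × 1# * ∣j∣ × 1#)                         ≡⟨ applySign-* (ℤ.sign i) (ℤ.sign j) _ _ ⟩
    applySign (ℤ.sign i) (∣i∣ × 1#) * applySign (ℤ.sign j) (∣j∣ × 1#) ≡⟨ cong₂ _*_ (fromℤ-sign i) (fromℤ-sign j) ⟨
    fromℤ i * fromℤ j                                          ∎
    where
    open ≡-Reasoning
    s = ℤ.sign i Sign.* ℤ.sign j
    ∣i∣ = ℤ.∣ i ∣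
    ∣j∣ = ℤ.∣ j ∣

  fromℤ-neg : ∀ i → fromℤ (ℤ.- i) ≡ - fromℤ i
  fromℤ-neg (ℤ.+ zero)    = sym -0#≈0#
  fromℤ-neg (ℤ.+ suc n)   = refl
  fromℤ-neg -[1+ n ]     = sym (-‿involutive _)

  fromℤ-homomorphism : ℤ.+-*-rawRing -Raw-AlmostCommutative⟶ fromCommutativeRing commutativeRing
  fromℤ-homomorphism = record
    { ⟦_⟧ = fromℤ ; +-homo = fromℤ-+ ; *-homo = fromℤ-* ; -‿homo = fromℤ-neg ; 0-homo = refl ; 1-homo = refl }

  fromℤ-equal? : ∀ i j → Maybe (fromℤ i ≡ fromℤ j)
  fromℤ-equal? i j with i ℤ.≟ j
  ... | yes refl = just refl
  ... | no _     = nothing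

  open Algebra.Solver.Ring ℤ.+-*-rawRing (fromCommutativeRing commutativeRing)
    fromℤ-homomorphism fromℤ-equal? public
    using (solve; _:+_; _:*_; :-_; _:=_; con)

module FiniteSums (ℝ : RealField) where
  open RealField ℝ
  open RealDefs ℝ
  open RingOfReals ℝ

  sumTo-cong-≤ : ∀ n {f g : ℕ → R} → (∀ k → k ℕ.≤ n → f k ≡ g k) → sumTo n f ≡ sumTo n g
  sumTo-cong-≤ zero    f≗g = f≗g 0 z≤n
  sumTo-cong-≤ (suc n) f≗g =
    cong₂ _+_ (sumTo-cong-≤ n (λ k k≤n → f≗g k (ℕₚ.m≤n⇒m≤1+n k≤n))) (f≗g (suc n) ℕₚ.≤-refl)

  sumTo-cong : ∀ n {f g : ℕ → R} → (∀ k → f k ≡ g k) → sumTo n f ≡ sumTo n g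
  sumTo-cong n f≗g = sumTo-cong-≤ n (λ k _ → f≗g k)

  sumTo-+ : ∀ n (f g : ℕ → R) → sumTo n (λ k → f k + g k) ≡ sumTo n f + sumTo n g
  sumTo-+ zero    f g = refl
  sumTo-+ (suc n) f g = begin
    sumTo n (λ k → f k + g k) + (f (suc n) + g (suc n)) ≡⟨ cong (_+ (f (suc n) + g (suc n))) (sumTo-+ n f g) ⟩
    sumTo n f + sumTo n g + (f (suc n) + g (suc n))     ≡⟨ solve 4 (λ a b c d → a :+ b :+ (c :+ d) := a :+ c :+ (b :+ d))
                                                                   refl (sumTo n f) (sumTo n g) (f (suc n)) (g (suc n)) ⟩
    sumTo n f + f (suc n) + (sumTo n g + g (suc n))     ∎
    where open ≡-Reasoning

  *-distribˡ-sumTo : ∀ n c (f : ℕ → R) → c * sumTo n f ≡ sumTo n (λ k → c * f k)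
  *-distribˡ-sumTo zero    c f = refl
  *-distribˡ-sumTo (suc n) c f =
    trans (distribˡ c (sumTo n f) (f (suc n))) (cong (_+ c * f (suc n)) (*-distribˡ-sumTo n c f))

  *-distribʳ-sumTo : ∀ n c (f : ℕ → R) → sumTo n f * c ≡ sumTo n (λ k → f k * c)
  *-distribʳ-sumTo n c f =
    trans (*-comm (sumTo n f) c) (trans (*-distribˡ-sumTo n c f) (sumTo-cong n (λ k → *-comm c (f k))))

  sumTo-sucˡ : ∀ n (f : ℕ → R) → sumTo (suc n) f ≡ f 0 + sumTo n (λ k → f (suc k))
  sumTo-sucˡ zero    f = refl
  sumTo-sucˡ (suc n) f = trans (cong (_+ f (suc (suc n))) (sumTo-sucˡ n f)) (+-assoc (f 0) _ _)

  sumTo-≡0 : ∀ n (f : ℕ → R) → (∀ k → k ℕ.≤ n → f k ≡ 0#) → sumTo n f ≡ 0#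
  sumTo-≡0 n f f≡0 = trans (sumTo-cong-≤ n f≡0) (zeros n)
    where
    zeros : ∀ n → sumTo n (λ _ → 0#) ≡ 0#
    zeros zero    = refl
    zeros (suc n) = trans (+-identityʳ _) (zeros n)

  sumTo-extend : ∀ {n m} (f : ℕ → R) → n ℕ.≤ m → (∀ k → n ℕ.< k → f k ≡ 0#) → sumTo m f ≡ sumTo n f
  sumTo-extend {n} f n≤m f≡0 with ℕₚ.m≤n⇒∃[o]m+o≡n n≤m
  ... | d , refl = extend d
    where
    extend : ∀ d → sumTo (n ℕ.+ d) f ≡ sumTo n f
    extend zero    = cong (λ k → sumTo k f) (ℕₚ.+-identityʳ n)
    extend (suc d) = begin
      sumTo (n ℕ.+ suc d) f            ≡⟨ cong (λ k → sumTo k f) (ℕₚ.+-suc n d) ⟩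
      sumTo (n ℕ.+ d) f + f (suc (n ℕ.+ d)) ≡⟨ cong₂ _+_ (extend d) (f≡0 _ (s≤s (ℕₚ.m≤m+n n d))) ⟩
      sumTo n f + 0#                   ≡⟨ +-identityʳ _ ⟩
      sumTo n f                        ∎
      where open ≡-Reasoning

  sumTo-reverse : ∀ n (f : ℕ → R) → sumTo n f ≡ sumTo n (λ k → f (n ∸ k))
  sumTo-reverse zero    f = refl
  sumTo-reverse (suc n) f =
    trans (cong (_+ f (suc n)) (sumTo-reverse n f))
          (trans (+-comm _ _) (sym (sumTo-sucˡ n (λ k → f (suc n ∸ k)))))

  sumTo-comm : ∀ n m (F : ℕ → ℕ → R) →
               sumTo n (λ i → sumTo m (λ j → F i j)) ≡ sumTo m (λ j → sumTo n (λ i → F i j))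
  sumTo-comm zero    m F = refl
  sumTo-comm (suc n) m F =
    trans (cong (_+ sumTo m (F (suc n))) (sumTo-comm n m F))
          (sym (sumTo-+ m (λ j → sumTo n (λ i → F i j)) (F (suc n))))

  sumTo-antidiagonal : ∀ n (F : ℕ → ℕ → R) →
    sumTo n (λ k → sumTo k (λ i → F i (k ∸ i))) ≡ sumTo n (λ i → sumTo (n ∸ i) (λ j → F i j))
  sumTo-antidiagonal zero    F = refl
  sumTo-antidiagonal (suc n) F = begin
    sumTo n (λ k → sumTo k (λ i → F i (k ∸ i))) + sumTo (suc n) (λ i → F i (suc n ∸ i))
      ≡⟨ cong (_+ sumTo (suc n) (λ i → F i (suc n ∸ i))) (sumTo-antidiagonal n F) ⟩
    sumTo n (λ i → sumTo (n ∸ i) (F i)) + (sumTo n (λ i → F i (suc n ∸ i)) + F (suc n) (n ∸ n))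
      ≡⟨ +-assoc _ _ _ ⟨
    sumTo n (λ i → sumTo (n ∸ i) (F i)) + sumTo n (λ i → F i (suc n ∸ i)) + F (suc n) (n ∸ n)
      ≡⟨ cong (_+ F (suc n) (n ∸ n)) (sumTo-+ n _ _) ⟨
    sumTo n (λ i → sumTo (n ∸ i) (F i) + F i (suc n ∸ i)) + F (suc n) (n ∸ n)
      ≡⟨ cong₂ _+_ (sumTo-cong-≤ n (λ i → sumTo-suc∸ {i})) lastTerm ⟨
    sumTo n (λ i → sumTo (suc n ∸ i) (F i)) + sumTo (suc n ∸ suc n) (F (suc n))
      ∎
    where
    open ≡-Reasoning
    sumTo-suc∸ : ∀ {i} → i ℕ.≤ n → sumTo (suc n ∸ i) (F i) ≡ sumTo (n ∸ i) (F i) + F i (suc n ∸ i)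
    sumTo-suc∸ i≤n rewrite ℕₚ.+-∸-assoc 1 i≤n = refl
    lastTerm : sumTo (n ∸ n) (F (suc n)) ≡ F (suc n) (n ∸ n)
    lastTerm rewrite ℕₚ.n∸n≡0 n = refl

  sumTo-triangle-comm : ∀ n (F : ℕ → ℕ → R) →
    sumTo n (λ k → sumTo (n ∸ k) (λ r → F k r)) ≡ sumTo n (λ r → sumTo (n ∸ r) (λ k → F k r))
  sumTo-triangle-comm n F = begin
    sumTo n (λ k → sumTo (n ∸ k) (λ r → F k r))
      ≡⟨ sumTo-antidiagonal n F ⟨
    sumTo n (λ m → sumTo m (λ k → F k (m ∸ k)))
      ≡⟨ sumTo-cong n (λ m → sumTo-reverse m _) ⟩
    sumTo n (λ m → sumTo m (λ k → F (m ∸ k) (m ∸ (m ∸ k))))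
      ≡⟨ sumTo-cong n (λ m → sumTo-cong-≤ m (λ k k≤m → cong (F (m ∸ k)) (ℕₚ.m∸[m∸n]≡n k≤m))) ⟩
    sumTo n (λ m → sumTo m (λ k → F (m ∸ k) k))
      ≡⟨ sumTo-antidiagonal n (λ r k → F k r) ⟩
    sumTo n (λ r → sumTo (n ∸ r) (λ k → F k r))
      ∎
    where open ≡-Reasoning

module NaturalEmbedding (ℝ : RealField) where
  open RealField ℝ
  open RealDefs ℝ
  open RingOfReals ℝ
  open FiniteSums ℝ

  open CommutativeRing commutativeRing using (semiring; commutativeSemiring)
  open import Algebra.Properties.Semiring.Mult semiring using (_×_; ×-homo-+; ×1-homo-*; ×-assoc-*)
  open import Algebra.Properties.Semiring.Sum semiring using (sum⁺-syntax)
  import Algebra.Properties.Semiring.Exp semiring as Exp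
  open import Algebra.Properties.CommutativeSemiring.Exp commutativeSemiring using (^-distrib-*)
  import Algebra.Properties.CommutativeSemiring.Binomial commutativeSemiring as Binomial
  open import Data.Fin using (toℕ)

  fromℕ≡×1# : ∀ n → fromℕ n ≡ n × 1#
  fromℕ≡×1# zero    = refl
  fromℕ≡×1# (suc n) = cong (1# +_) (fromℕ≡×1# n)

  ^≡Exp^ : ∀ x n → x ^ n ≡ x Exp.^ n
  ^≡Exp^ x zero    = refl
  ^≡Exp^ x (suc n) = cong (x *_) (^≡Exp^ x n)

  fromℕ-+ : ∀ m n → fromℕ (m ℕ.+ n) ≡ fromℕ m + fromℕ n
  fromℕ-+ m n = begin
    fromℕ (m ℕ.+ n)       ≡⟨ fromℕ≡×1# (m ℕ.+ n) ⟩
    (m ℕ.+ n) × 1#        ≡⟨ ×-homo-+ 1# m n ⟩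
    m × 1# + n × 1#       ≡⟨ cong₂ _+_ (fromℕ≡×1# m) (fromℕ≡×1# n) ⟨
    fromℕ m + fromℕ n     ∎
    where open ≡-Reasoning

  fromℕ-* : ∀ m n → fromℕ (m ℕ.* n) ≡ fromℕ m * fromℕ n
  fromℕ-* m n = begin
    fromℕ (m ℕ.* n)       ≡⟨ fromℕ≡×1# (m ℕ.* n) ⟩
    (m ℕ.* n) × 1#        ≡⟨ ×1-homo-* m n ⟩
    m × 1# * n × 1#       ≡⟨ cong₂ _*_ (fromℕ≡×1# m) (fromℕ≡×1# n) ⟨
    fromℕ m * fromℕ n     ∎
    where open ≡-Reasoning

  ×≡fromℕ* : ∀ n x → n × x ≡ fromℕ n * x
  ×≡fromℕ* n x = begin
    n × x                 ≡⟨ cong (n ×_) (*-identityˡ x) ⟨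
    n × (1# * x)          ≡⟨ ×-assoc-* n 1# x ⟨
    n × 1# * x            ≡⟨ cong (_* x) (fromℕ≡×1# n) ⟨
    fromℕ n * x           ∎
    where open ≡-Reasoning

  ^-+ : ∀ x m n → x ^ (m ℕ.+ n) ≡ x ^ m * x ^ n
  ^-+ x zero    n = sym (*-identityˡ _)
  ^-+ x (suc m) n = trans (cong (x *_) (^-+ x m n)) (sym (*-assoc _ _ _))

  ^-* : ∀ x y n → (x * y) ^ n ≡ x ^ n * y ^ n
  ^-* x y n = begin
    (x * y) ^ n               ≡⟨ ^≡Exp^ (x * y) n ⟩
    (x * y) Exp.^ n           ≡⟨ ^-distrib-* x y n ⟩
    x Exp.^ n * y Exp.^ n     ≡⟨ cong₂ _*_ (^≡Exp^ x n) (^≡Exp^ y n) ⟨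
    x ^ n * y ^ n             ∎
    where open ≡-Reasoning

  -x^n≡[-1]^n*x^n : ∀ x n → (- x) ^ n ≡ (- 1#) ^ n * x ^ n
  -x^n≡[-1]^n*x^n x n = trans (cong (_^ n) (solve 1 (λ x → :- x := :- con (ℤ.+ 1) :* x) refl x)) (^-* (- 1#) x n)

  sumTo≡∑ : ∀ n (f : ℕ → R) → sumTo n f ≡ ∑[ k ≤ n ] f (toℕ k)
  sumTo≡∑ zero    f = sym (+-identityʳ (f 0))
  sumTo≡∑ (suc n) f = trans (sumTo-sucˡ n f) (cong (f 0 +_) (sumTo≡∑ n (λ k → f (suc k))))

  binomial-theorem : ∀ x y n → (x + y) ^ n ≡ sumTo n (λ k → fromℕ (n C k) * (x ^ k * y ^ (n ∸ k)))
  binomial-theorem x y n = begin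
    (x + y) ^ n
      ≡⟨ ^≡Exp^ (x + y) n ⟩
    (x + y) Exp.^ n
      ≡⟨ Binomial.theorem n x y ⟩
    ∑[ k ≤ n ] ((n C toℕ k) × (x Exp.^ toℕ k * y Exp.^ (n ∸ toℕ k)))
      ≡⟨ sumTo≡∑ n term ⟨
    sumTo n term
      ≡⟨ sumTo-cong n (λ k → trans (×≡fromℕ* (n C k) _)
                                  (cong (fromℕ (n C k) *_) (sym (cong₂ _*_ (^≡Exp^ x k) (^≡Exp^ y (n ∸ k)))))) ⟩
    sumTo n (λ k → fromℕ (n C k) * (x ^ k * y ^ (n ∸ k)))
      ∎
    where
    open ≡-Reasoning
    term : ℕ → R
    term k = (n C k) × (x Exp.^ k * y Exp.^ (n ∸ k))

module FactorialInverses (ℝ : RealField) where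
  open RealField ℝ
  open RealDefs ℝ
  open RingOfReals ℝ
  open FiniteSums ℝ
  open NaturalEmbedding ℝ

  inverse-unique : ∀ {a b c} → a * b ≡ 1# → a * c ≡ 1# → b ≡ c
  inverse-unique {a} {b} {c} ab≡1 ac≡1 = begin
    b             ≡⟨ *-identityʳ b ⟨
    b * 1#        ≡⟨ cong (b *_) ac≡1 ⟨
    b * (a * c)   ≡⟨ solve 3 (λ a b c → b :* (a :* c) := a :* b :* c) refl a b c ⟩
    a * b * c     ≡⟨ cong (_* c) ab≡1 ⟩
    1# * c        ≡⟨ *-identityˡ c ⟩
    c             ∎
    where open ≡-Reasoning

  fromℕ-!*invℕ-! : ∀ n → fromℕ (n !) * invℕ (n !) ≡ 1#
  fromℕ-!*invℕ-! n with n ! | ℕₚ.1≤n! n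
  ... | suc m | _ = inv-correct (fromℕ (suc m)) (fromℕ-suc≢0 m)

  invℕ-1 : invℕ 1 ≡ 1#
  invℕ-1 = inverse-unique (fromℕ-!*invℕ-! 1) (trans (*-identityʳ (fromℕ 1)) (+-identityʳ 1#))

  fromℕ-!-binomial : ∀ {n k} → k ℕ.≤ n → fromℕ (n C k) * fromℕ (k !) * fromℕ ((n ∸ k) !) ≡ fromℕ (n !)
  fromℕ-!-binomial {n} {k} k≤n = begin
    fromℕ (n C k) * fromℕ (k !) * fromℕ ((n ∸ k) !)   ≡⟨ *-assoc _ _ _ ⟩
    fromℕ (n C k) * (fromℕ (k !) * fromℕ ((n ∸ k) !)) ≡⟨ cong (fromℕ (n C k) *_) (fromℕ-* (k !) ((n ∸ k) !)) ⟨
    fromℕ (n C k) * fromℕ (k ! ℕ.* (n ∸ k) !)         ≡⟨ fromℕ-* (n C k) _ ⟨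
    fromℕ ((n C k) ℕ.* (k ! ℕ.* (n ∸ k) !))           ≡⟨ cong fromℕ (nCk*[k!*[n∸k]!]≡n! k≤n) ⟩
    fromℕ (n !)                                       ∎
    where open ≡-Reasoning

  fromℕ-suc*invℕ-suc! : ∀ n → fromℕ (suc n) * invℕ (suc n !) ≡ invℕ (n !)
  fromℕ-suc*invℕ-suc! n = inverse-unique (begin
    fromℕ (n !) * (fromℕ (suc n) * invℕ (suc n !))  ≡⟨ *-assoc _ _ _ ⟨
    fromℕ (n !) * fromℕ (suc n) * invℕ (suc n !)    ≡⟨ cong (_* invℕ (suc n !)) (*-comm _ _) ⟩
    fromℕ (suc n) * fromℕ (n !) * invℕ (suc n !)    ≡⟨ cong (_* invℕ (suc n !)) (fromℕ-* (suc n) (n !)) ⟨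
    fromℕ (suc n !) * invℕ (suc n !)                ≡⟨ fromℕ-!*invℕ-! (suc n) ⟩
    1#                                              ∎) (fromℕ-!*invℕ-! n)
    where open ≡-Reasoning

  fromℕ-C*invℕ-! : ∀ {n k} → k ℕ.≤ n → fromℕ (n C k) * invℕ (n !) ≡ invℕ (k !) * invℕ ((n ∸ k) !)
  fromℕ-C*invℕ-! {n} {k} k≤n = inverse-unique
    (begin
      k! * m! * (c * invℕ (n !))   ≡⟨ solve 4 (λ a b c i → a :* b :* (c :* i) := c :* a :* b :* i) refl k! m! c (invℕ (n !)) ⟩
      c * k! * m! * invℕ (n !)     ≡⟨ cong (_* invℕ (n !)) (fromℕ-!-binomial k≤n) ⟩
      fromℕ (n !) * invℕ (n !)     ≡⟨ fromℕ-!*invℕ-! n ⟩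
      1#                           ∎)
    (begin
      k! * m! * (invℕ (k !) * invℕ ((n ∸ k) !))         ≡⟨ solve 4 (λ a b i j → a :* b :* (i :* j) := a :* i :* (b :* j)) refl k! m! _ _ ⟩
      k! * invℕ (k !) * (m! * invℕ ((n ∸ k) !))         ≡⟨ cong₂ _*_ (fromℕ-!*invℕ-! k) (fromℕ-!*invℕ-! (n ∸ k)) ⟩
      1# * 1#                                           ≡⟨ *-identityʳ 1# ⟩
      1#                                                ∎)
    where
    open ≡-Reasoning
    c = fromℕ (n C k)
    k! = fromℕ (k !)
    m! = fromℕ ((n ∸ k) !)

  fromℕ-!-*-sumTo : ∀ n (u v : ℕ → R) →
    fromℕ (n !) * sumTo n (λ k → u k * v k)
      ≡ sumTo n (λ k → fromℕ (n C k) * (fromℕ (k !) * u k) * (fromℕ ((n ∸ k) !) * v k))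
  fromℕ-!-*-sumTo n u v = trans (*-distribˡ-sumTo n _ _) (sumTo-cong-≤ n term)
    where
    open ≡-Reasoning
    term : ∀ k → k ℕ.≤ n → fromℕ (n !) * (u k * v k)
                         ≡ fromℕ (n C k) * (fromℕ (k !) * u k) * (fromℕ ((n ∸ k) !) * v k)
    term k k≤n = begin
      fromℕ (n !) * (u k * v k)
        ≡⟨ cong (_* (u k * v k)) (fromℕ-!-binomial k≤n) ⟨
      fromℕ (n C k) * fromℕ (k !) * fromℕ ((n ∸ k) !) * (u k * v k)
        ≡⟨ solve 5 (λ c f g u v → c :* f :* g :* (u :* v) := c :* (f :* u) :* (g :* v)) refl _ _ _ _ _ ⟩
      fromℕ (n C k) * (fromℕ (k !) * u k) * (fromℕ ((n ∸ k) !) * v k)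
        ∎

module PowerSeries (ℝ : RealField) where
  open RealField ℝ
  open RealDefs ℝ
  open RingOfReals ℝ
  open FiniteSums ℝ
  open NaturalEmbedding ℝ
  open FactorialInverses ℝ

  ⊛-cong : ∀ {f f′ g g′ : PS} → f ≗ f′ → g ≗ g′ → f ⊛ g ≗ f′ ⊛ g′
  ⊛-cong f≗f′ g≗g′ n = sumTo-cong n (λ k → cong₂ _*_ (f≗f′ k) (g≗g′ (n ∸ k)))

  ⊛-comm : ∀ (f g : PS) → f ⊛ g ≗ g ⊛ f
  ⊛-comm f g n = trans (sumTo-reverse n _) (sumTo-cong-≤ n (λ k k≤n →
    trans (*-comm _ _) (cong (λ i → g i * f (n ∸ k)) (ℕₚ.m∸[m∸n]≡n k≤n))))

  ⊛-assoc : ∀ (f g h : PS) → (f ⊛ g) ⊛ h ≗ f ⊛ (g ⊛ h)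
  ⊛-assoc f g h n = begin
    sumTo n (λ k → sumTo k (λ i → f i * g (k ∸ i)) * h (n ∸ k))
      ≡⟨ sumTo-cong n (λ k → *-distribʳ-sumTo k _ _) ⟩
    sumTo n (λ k → sumTo k (λ i → f i * g (k ∸ i) * h (n ∸ k)))
      ≡⟨ sumTo-cong n (λ k → sumTo-cong-≤ k (λ i i≤k → cong (λ m → f i * g (k ∸ i) * h (n ∸ m)) (ℕₚ.m+[n∸m]≡n i≤k))) ⟨
    sumTo n (λ k → sumTo k (λ i → F i (k ∸ i)))
      ≡⟨ sumTo-antidiagonal n F ⟩
    sumTo n (λ i → sumTo (n ∸ i) (λ j → F i j))
      ≡⟨ sumTo-cong n (λ i → sumTo-cong (n ∸ i) (λ j → trans (sym (*-assoc _ _ _)) (cong (λ m → f i * g j * h m) (ℕₚ.∸-+-assoc n i j)))) ⟨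
    sumTo n (λ i → sumTo (n ∸ i) (λ j → f i * (g j * h (n ∸ i ∸ j))))
      ≡⟨ sumTo-cong n (λ i → *-distribˡ-sumTo (n ∸ i) (f i) _) ⟨
    sumTo n (λ i → f i * sumTo (n ∸ i) (λ j → g j * h (n ∸ i ∸ j)))
      ∎
    where
    open ≡-Reasoning
    F : ℕ → ℕ → R
    F i j = f i * g j * h (n ∸ (i ℕ.+ j))

  ·-⊛ : ∀ c (f g : PS) → (c · f) ⊛ g ≗ c · (f ⊛ g)
  ·-⊛ c f g n = trans (sumTo-cong n (λ k → *-assoc _ _ _)) (sym (*-distribˡ-sumTo n c _))

  ⊛-identityˡ : ∀ (f : PS) → onePS ⊛ f ≗ f
  ⊛-identityˡ f zero    = *-identityˡ _
  ⊛-identityˡ f (suc n) = begin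
    (onePS ⊛ f) (suc n)                                   ≡⟨ sumTo-sucˡ n _ ⟩
    1# * f (suc n) + sumTo n (λ k → 0# * f (n ∸ k))       ≡⟨ cong₂ _+_ (*-identityˡ _) (sumTo-≡0 n _ (λ k _ → zeroˡ _)) ⟩
    f (suc n) + 0#                                        ≡⟨ +-identityʳ _ ⟩
    f (suc n)                                             ∎
    where open ≡-Reasoning

  ⊛-identityʳ : ∀ (f : PS) → f ⊛ onePS ≗ f
  ⊛-identityʳ f n = trans (⊛-comm f onePS n) (⊛-identityˡ f n)

  expLin-+ : ∀ x y → expLin (x + y) ≗ expLin x ⊛ expLin y
  expLin-+ x y n = begin
    (x + y) ^ n * invℕ (n !)
      ≡⟨ cong (_* invℕ (n !)) (binomial-theorem x y n) ⟩
    sumTo n (λ k → fromℕ (n C k) * (x ^ k * y ^ (n ∸ k))) * invℕ (n !)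
      ≡⟨ *-distribʳ-sumTo n _ _ ⟩
    sumTo n (λ k → fromℕ (n C k) * (x ^ k * y ^ (n ∸ k)) * invℕ (n !))
      ≡⟨ sumTo-cong-≤ n term ⟩
    sumTo n (λ k → x ^ k * invℕ (k !) * (y ^ (n ∸ k) * invℕ ((n ∸ k) !)))
      ∎
    where
    open ≡-Reasoning
    term : ∀ k → k ℕ.≤ n → fromℕ (n C k) * (x ^ k * y ^ (n ∸ k)) * invℕ (n !)
                         ≡ x ^ k * invℕ (k !) * (y ^ (n ∸ k) * invℕ ((n ∸ k) !))
    term k k≤n = begin
      fromℕ (n C k) * (a * b) * invℕ (n !)          ≡⟨ solve 4 (λ c a b i → c :* (a :* b) :* i := c :* i :* (a :* b)) refl _ a b _ ⟩
      fromℕ (n C k) * invℕ (n !) * (a * b)          ≡⟨ cong (_* (a * b)) (fromℕ-C*invℕ-! k≤n) ⟩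
      invℕ (k !) * invℕ ((n ∸ k) !) * (a * b)       ≡⟨ solve 4 (λ i j a b → i :* j :* (a :* b) := a :* i :* (b :* j)) refl _ _ a b ⟩
      a * invℕ (k !) * (b * invℕ ((n ∸ k) !))       ∎
      where
      a = x ^ k
      b = y ^ (n ∸ k)

  powPS-· : ∀ c (G : PS) m → powPS (c · G) m ≗ (c ^ m) · powPS G m
  powPS-· c G zero    n = sym (*-identityˡ _)
  powPS-· c G (suc m) n = begin
    ((c · G) ⊛ powPS (c · G) m) n            ≡⟨ ⊛-cong {g′ = (c ^ m) · powPS G m} (λ _ → refl) (powPS-· c G m) n ⟩
    ((c · G) ⊛ ((c ^ m) · powPS G m)) n      ≡⟨ ·-⊛ c G ((c ^ m) · powPS G m) n ⟩
    c * (G ⊛ ((c ^ m) · powPS G m)) n        ≡⟨ cong (c *_) (⊛-comm G ((c ^ m) · powPS G m) n) ⟩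
    c * (((c ^ m) · powPS G m) ⊛ G) n        ≡⟨ cong (c *_) (·-⊛ (c ^ m) (powPS G m) G n) ⟩
    c * (c ^ m * (powPS G m ⊛ G) n)          ≡⟨ cong (λ z → c * (c ^ m * z)) (⊛-comm (powPS G m) G n) ⟩
    c * (c ^ m * (G ⊛ powPS G m) n)          ≡⟨ *-assoc _ _ _ ⟨
    c ^ suc m * powPS G (suc m) n            ∎
    where open ≡-Reasoning

  powPS-+ : ∀ (G : PS) i j → powPS G (i ℕ.+ j) ≗ powPS G i ⊛ powPS G j
  powPS-+ G zero    j n = sym (⊛-identityˡ (powPS G j) n)
  powPS-+ G (suc i) j n =
    trans (⊛-cong {g′ = powPS G i ⊛ powPS G j} (λ _ → refl) (powPS-+ G i j) n) (sym (⊛-assoc G (powPS G i) (powPS G j) n))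

  powPS-vanishes : ∀ (G : PS) → G 0 ≡ 0# → ∀ {m n} → n ℕ.< m → powPS G m n ≡ 0#
  powPS-vanishes G G0≡0 {suc m} {n} n<m = sumTo-≡0 n _ (term n n<m)
    where
    term : ∀ n → n ℕ.< suc m → ∀ k → k ℕ.≤ n → G k * powPS G m (n ∸ k) ≡ 0#
    term n       _          zero    _         = trans (cong (_* powPS G m n) G0≡0) (zeroˡ _)
    term (suc n) (s≤s n<m) (suc k) (s≤s k≤n) =
      trans (cong (G (suc k) *_) (powPS-vanishes G G0≡0 (ℕₚ.≤-<-trans (ℕₚ.m∸n≤m n k) n<m))) (zeroʳ _)

  -- The only term, m = 0, carries the factor invℕ 0 = 0#.
  logPS-constant : ∀ (F : PS) → logPS F 0 ≡ 0#
  logPS-constant F = trans (cong (_* powPS (F ⊕ ((- 1#) · onePS)) 0 0) (zeroʳ _)) (zeroˡ _)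

module ExponentialLaw (ℝ : RealField) (L : RealDefs.PS ℝ) (L₀≡0 : L 0 ≡ RealField.0# ℝ) where
  open RealField ℝ
  open RealDefs ℝ
  open RingOfReals ℝ
  open FiniteSums ℝ
  open PowerSeries ℝ

  P : ℕ → PS
  P = powPS L

  expPS-·-expansion : ∀ α {n N} → n ℕ.≤ N → expPS (α · L) n ≡ sumTo N (λ m → expLin α m * P m n)
  expPS-·-expansion α {n} {N} n≤N = begin
    expPS (α · L) n                        ≡⟨ sumTo-cong n (λ m → cong (invℕ (m !) *_) (powPS-· α L m n)) ⟩
    sumTo n (λ m → invℕ (m !) * (α ^ m * P m n)) ≡⟨ sumTo-cong n (λ m → solve 3 (λ i a p → i :* (a :* p) := a :* i :* p) refl _ _ _) ⟩
    sumTo n (λ m → expLin α m * P m n)     ≡⟨ sumTo-extend _ n≤N (λ m n<m → trans (cong (expLin α m *_) (powPS-vanishes L L₀≡0 n<m)) (zeroʳ _)) ⟨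
    sumTo N (λ m → expLin α m * P m n)     ∎
    where open ≡-Reasoning

  private
    double : R → R → ℕ → R
    double α β n = sumTo n (λ i → sumTo n (λ j → expLin α i * expLin β j * P (i ℕ.+ j) n))

  expPS-+-double : ∀ α β n → expPS ((α + β) · L) n ≡ double α β n
  expPS-+-double α β n = begin
    expPS ((α + β) · L) n
      ≡⟨ expPS-·-expansion (α + β) (ℕₚ.≤-refl {n}) ⟩
    sumTo n (λ m → expLin (α + β) m * P m n)
      ≡⟨ sumTo-cong n (λ m → trans (cong (_* P m n) (expLin-+ α β m)) (*-distribʳ-sumTo m _ _)) ⟩
    sumTo n (λ m → sumTo m (λ i → expLin α i * expLin β (m ∸ i) * P m n))
      ≡⟨ sumTo-cong n (λ m → sumTo-cong-≤ m (λ i i≤m → cong (λ k → expLin α i * expLin β (m ∸ i) * P k n) (ℕₚ.m+[n∸m]≡n i≤m))) ⟨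
    sumTo n (λ m → sumTo m (λ i → F i (m ∸ i)))
      ≡⟨ sumTo-antidiagonal n F ⟩
    sumTo n (λ i → sumTo (n ∸ i) (F i))
      ≡⟨ sumTo-cong-≤ n (λ i i≤n → sumTo-extend (F i) (ℕₚ.m∸n≤m n i) (λ j n∸i<j → F-vanishes i≤n n∸i<j)) ⟨
    double α β n
      ∎
    where
    open ≡-Reasoning
    F : ℕ → ℕ → R
    F i j = expLin α i * expLin β j * P (i ℕ.+ j) n
    F-vanishes : ∀ {i j} → i ℕ.≤ n → n ∸ i ℕ.< j → F i j ≡ 0#
    F-vanishes {i} {j} i≤n n∸i<j = trans (cong (expLin α i * expLin β j *_) (powPS-vanishes L L₀≡0 n<i+j)) (zeroʳ _)
      where
      n<i+j : n ℕ.< i ℕ.+ j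
      n<i+j = subst (ℕ._< i ℕ.+ j) (ℕₚ.m+[n∸m]≡n i≤n) (ℕₚ.+-monoʳ-< i n∸i<j)

  ⊛-double : ∀ α β n → (expPS (α · L) ⊛ expPS (β · L)) n ≡ double α β n
  ⊛-double α β n = begin
    sumTo n (λ k → expPS (α · L) k * expPS (β · L) (n ∸ k))
      ≡⟨ sumTo-cong-≤ n (λ k k≤n → cong₂ _*_ (expPS-·-expansion α k≤n) (expPS-·-expansion β (ℕₚ.m∸n≤m n k))) ⟩
    sumTo n (λ k → sumTo n (λ i → expLin α i * P i k) * sumTo n (λ j → expLin β j * P j (n ∸ k)))
      ≡⟨ sumTo-cong n (λ k → trans (*-distribʳ-sumTo n _ _) (sumTo-cong n (λ i → *-distribˡ-sumTo n _ _))) ⟩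
    sumTo n (λ k → sumTo n (λ i → sumTo n (λ j → expLin α i * P i k * (expLin β j * P j (n ∸ k)))))
      ≡⟨ sumTo-comm n n _ ⟩
    sumTo n (λ i → sumTo n (λ k → sumTo n (λ j → expLin α i * P i k * (expLin β j * P j (n ∸ k)))))
      ≡⟨ sumTo-cong n (λ i → sumTo-comm n n _) ⟩
    sumTo n (λ i → sumTo n (λ j → sumTo n (λ k → expLin α i * P i k * (expLin β j * P j (n ∸ k)))))
      ≡⟨ sumTo-cong n (λ i → sumTo-cong n (λ j → inner i j)) ⟩
    double α β n
      ∎
    where
    open ≡-Reasoning
    inner : ∀ i j → sumTo n (λ k → expLin α i * P i k * (expLin β j * P j (n ∸ k)))
                  ≡ expLin α i * expLin β j * P (i ℕ.+ j) n
    inner i j = begin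
      sumTo n (λ k → expLin α i * P i k * (expLin β j * P j (n ∸ k)))
        ≡⟨ sumTo-cong n (λ k → solve 4 (λ a p b q → a :* p :* (b :* q) := a :* b :* (p :* q)) refl _ _ _ _) ⟩
      sumTo n (λ k → expLin α i * expLin β j * (P i k * P j (n ∸ k)))
        ≡⟨ *-distribˡ-sumTo n _ _ ⟨
      expLin α i * expLin β j * (P i ⊛ P j) n
        ≡⟨ cong (expLin α i * expLin β j *_) (powPS-+ L i j n) ⟨
      expLin α i * expLin β j * P (i ℕ.+ j) n
        ∎

  expPS-·-+ : ∀ α β → expPS ((α + β) · L) ≗ expPS (α · L) ⊛ expPS (β · L)
  expPS-·-+ α β n = trans (expPS-+-double α β n) (sym (⊛-double α β n))

module FiniteDifferences (ℝ : RealField) where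
  open RealField ℝ
  open RealDefs ℝ
  open RingOfReals ℝ
  open FiniteSums ℝ
  open NaturalEmbedding ℝ

  Δ : ℕ → (ℕ → R) → R
  Δ N f = sumTo N (λ l → fromℕ (N C l) * ((- 1#) ^ (N ∸ l) * f l))

  Δ-cong : ∀ N {f g : ℕ → R} → f ≗ g → Δ N f ≡ Δ N g
  Δ-cong N f≗g = sumTo-cong N (λ l → cong (λ z → fromℕ (N C l) * ((- 1#) ^ (N ∸ l) * z)) (f≗g l))

  Δ-polynomial : ∀ N J (b : ℕ → R) →
    Δ N (λ l → sumTo J (λ j → b j * fromℕ l ^ j)) ≡ sumTo J (λ j → b j * Δ N (λ l → fromℕ l ^ j))
  Δ-polynomial N J b = begin
    sumTo N (λ l → fromℕ (N C l) * ((- 1#) ^ (N ∸ l) * sumTo J (λ j → b j * fromℕ l ^ j)))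
      ≡⟨ sumTo-cong N (λ l → trans (cong (fromℕ (N C l) *_) (*-distribˡ-sumTo J _ _)) (*-distribˡ-sumTo J _ _)) ⟩
    sumTo N (λ l → sumTo J (λ j → fromℕ (N C l) * ((- 1#) ^ (N ∸ l) * (b j * fromℕ l ^ j))))
      ≡⟨ sumTo-comm N J _ ⟩
    sumTo J (λ j → sumTo N (λ l → fromℕ (N C l) * ((- 1#) ^ (N ∸ l) * (b j * fromℕ l ^ j))))
      ≡⟨ sumTo-cong J (λ j → trans (sumTo-cong N (λ l → solve 4 (λ c s b p → c :* (s :* (b :* p)) := b :* (c :* (s :* p))) refl _ _ _ _))
                                    (sym (*-distribˡ-sumTo N _ _))) ⟩
    sumTo J (λ j → b j * Δ N (λ l → fromℕ l ^ j))
      ∎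
    where open ≡-Reasoning

  [1+M]C[1+l]*[1+l]≡[1+M]*MCl : ∀ M l → fromℕ (suc M C suc l) * fromℕ (suc l) ≡ fromℕ (suc M) * fromℕ (M C l)
  [1+M]C[1+l]*[1+l]≡[1+M]*MCl M l = begin
    fromℕ (suc M C suc l) * fromℕ (suc l)   ≡⟨ *-comm _ _ ⟩
    fromℕ (suc l) * fromℕ (suc M C suc l)   ≡⟨ fromℕ-* (suc l) (suc M C suc l) ⟨
    fromℕ (suc l ℕ.* (suc M C suc l))       ≡⟨ cong fromℕ ([1+k]*[1+n]C[1+k]≡[1+n]*nCk M l) ⟩
    fromℕ (suc M ℕ.* (M C l))               ≡⟨ fromℕ-* (suc M) (M C l) ⟩
    fromℕ (suc M) * fromℕ (M C l)           ∎
    where open ≡-Reasoning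

  Δ-absorb : ∀ M (g : ℕ → R) → Δ (suc M) (λ l → fromℕ l * g l) ≡ fromℕ (suc M) * Δ M (λ l → g (suc l))
  Δ-absorb M g = begin
    Δ (suc M) (λ l → fromℕ l * g l)
      ≡⟨ sumTo-sucˡ M _ ⟩
    fromℕ 1 * ((- 1#) ^ suc M * (0# * g 0)) + sumTo M term
      ≡⟨ cong (_+ sumTo M term) (trans (cong (λ z → fromℕ 1 * ((- 1#) ^ suc M * z)) (zeroˡ _))
                                      (trans (cong (fromℕ 1 *_) (zeroʳ _)) (zeroʳ _))) ⟩
    0# + sumTo M term
      ≡⟨ +-identityˡ _ ⟩
    sumTo M term
      ≡⟨ sumTo-cong M absorb ⟩
    sumTo M (λ l → fromℕ (suc M) * (fromℕ (M C l) * ((- 1#) ^ (M ∸ l) * g (suc l))))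
      ≡⟨ *-distribˡ-sumTo M _ _ ⟨
    fromℕ (suc M) * Δ M (λ l → g (suc l))
      ∎
    where
    open ≡-Reasoning
    term : ℕ → R
    term l = fromℕ (suc M C suc l) * ((- 1#) ^ (M ∸ l) * (fromℕ (suc l) * g (suc l)))
    absorb : ∀ l → term l ≡ fromℕ (suc M) * (fromℕ (M C l) * ((- 1#) ^ (M ∸ l) * g (suc l)))
    absorb l = begin
      term l                                                     ≡⟨ solve 4 (λ c s u g → c :* (s :* (u :* g)) := c :* u :* (s :* g)) refl _ _ _ _ ⟩
      fromℕ (suc M C suc l) * fromℕ (suc l) * ((- 1#) ^ (M ∸ l) * g (suc l)) ≡⟨ cong (_* ((- 1#) ^ (M ∸ l) * g (suc l))) ([1+M]C[1+l]*[1+l]≡[1+M]*MCl M l) ⟩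
      fromℕ (suc M) * fromℕ (M C l) * ((- 1#) ^ (M ∸ l) * g (suc l)) ≡⟨ *-assoc _ _ _ ⟩
      fromℕ (suc M) * (fromℕ (M C l) * ((- 1#) ^ (M ∸ l) * g (suc l))) ∎

  1^n≡1 : ∀ n → 1# ^ n ≡ 1#
  1^n≡1 zero    = refl
  1^n≡1 (suc n) = trans (*-identityˡ _) (1^n≡1 n)

  Δ-const : ∀ M → Δ (suc M) (λ l → fromℕ l ^ 0) ≡ 0#
  Δ-const M = begin
    Δ (suc M) (λ _ → 1#)
      ≡⟨ sumTo-cong (suc M) (λ l → cong (fromℕ (suc M C l) *_) (trans (*-comm _ _) (cong (_* (- 1#) ^ (suc M ∸ l)) (sym (1^n≡1 l))))) ⟩
    sumTo (suc M) (λ l → fromℕ (suc M C l) * (1# ^ l * (- 1#) ^ (suc M ∸ l)))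
      ≡⟨ binomial-theorem 1# (- 1#) (suc M) ⟨
    (1# + - 1#) ^ suc M
      ≡⟨ cong (_^ suc M) (+-inverseʳ 1#) ⟩
    0# * 0# ^ M
      ≡⟨ zeroˡ _ ⟩
    0#
      ∎
    where open ≡-Reasoning

  Δ-power-vanishes : ∀ N j → j ℕ.< N → Δ N (λ l → fromℕ l ^ j) ≡ 0#
  Δ-polynomial-vanishes : ∀ N J (b : ℕ → R) → J ℕ.< N → Δ N (λ l → sumTo J (λ j → b j * fromℕ l ^ j)) ≡ 0#

  Δ-power-vanishes (suc M) zero    _           = Δ-const M
  Δ-power-vanishes (suc M) (suc j) (s≤s j<M) = begin
    Δ (suc M) (λ l → fromℕ l * fromℕ l ^ j)                   ≡⟨ Δ-absorb M (λ l → fromℕ l ^ j) ⟩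
    fromℕ (suc M) * Δ M (λ l → fromℕ (suc l) ^ j)             ≡⟨ cong (fromℕ (suc M) *_) (Δ-cong M expand) ⟩
    fromℕ (suc M) * Δ M (λ l → sumTo j (λ i → b i * fromℕ l ^ i)) ≡⟨ cong (fromℕ (suc M) *_) (Δ-polynomial-vanishes M j b j<M) ⟩
    fromℕ (suc M) * 0#                                        ≡⟨ zeroʳ _ ⟩
    0#                                                        ∎
    where
    open ≡-Reasoning
    b : ℕ → R
    b i = fromℕ (j C i) * 1# ^ (j ∸ i)
    expand : ∀ l → fromℕ (suc l) ^ j ≡ sumTo j (λ i → b i * fromℕ l ^ i)
    expand l = trans (cong (_^ j) (+-comm 1# (fromℕ l)))
                     (trans (binomial-theorem (fromℕ l) 1# j)
                            (sumTo-cong j (λ i → solve 3 (λ c p o → c :* (p :* o) := c :* o :* p) refl _ _ _)))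

  Δ-polynomial-vanishes N J b J<N = begin
    Δ N (λ l → sumTo J (λ j → b j * fromℕ l ^ j))        ≡⟨ Δ-polynomial N J b ⟩
    sumTo J (λ j → b j * Δ N (λ l → fromℕ l ^ j))        ≡⟨ sumTo-≡0 J _ (λ j j≤J →
                                                              trans (cong (b j *_) (Δ-power-vanishes N j (ℕₚ.≤-<-trans j≤J J<N))) (zeroʳ _)) ⟩
    0#                                                    ∎
    where open ≡-Reasoning

module AbelKernel (ℝ : RealField) (q : RealField.R ℝ) where
  open RealField ℝ
  open RealDefs ℝ
  open RingOfReals ℝ
  open FiniteSums ℝ
  open NaturalEmbedding ℝ
  open FactorialInverses ℝ
  open FiniteDifferences ℝ
  open PowerSeries ℝ

  1+qt : PS
  1+qt zero          = 1#
  1+qt (suc zero)    = q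
  1+qt (suc (suc _)) = 0#

  1+qt-⊛-zero : ∀ (c : PS) → (1+qt ⊛ c) 0 ≡ c 0
  1+qt-⊛-zero c = *-identityˡ _

  1+qt-⊛-suc : ∀ (c : PS) m → (1+qt ⊛ c) (suc m) ≡ c (suc m) + q * c m
  1+qt-⊛-suc c zero    = cong (_+ q * c 0) (*-identityˡ _)
  1+qt-⊛-suc c (suc m) = begin
    (1+qt ⊛ c) (suc (suc m))                                                ≡⟨ sumTo-sucˡ (suc m) _ ⟩
    1# * c (suc (suc m)) + sumTo (suc m) (λ k → 1+qt (suc k) * c (suc m ∸ k)) ≡⟨ cong₂ _+_ (*-identityˡ _) (sumTo-sucˡ m _) ⟩
    c (suc (suc m)) + (q * c (suc m) + sumTo m (λ k → 0# * c (m ∸ k)))      ≡⟨ cong (λ z → c (suc (suc m)) + (q * c (suc m) + z)) (sumTo-≡0 m _ (λ k _ → zeroˡ _)) ⟩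
    c (suc (suc m)) + (q * c (suc m) + 0#)                                   ≡⟨ cong (c (suc (suc m)) +_) (+-identityʳ _) ⟩
    c (suc (suc m)) + q * c (suc m)                                          ∎
    where open ≡-Reasoning

  kernel : R → PS
  kernel z = 1+qt ⊛ expLin z

  shifted : R → ℕ → R
  shifted X l = X - q * fromℕ l

  -- With z = X - q l one has z + q l = X, so the kernel coefficient is X z^(l-1) / l!.
  kernel-term : ∀ X M l → l ℕ.≤ suc M →
    kernel (shifted X l) l * expLin (- shifted X l) (suc M ∸ l)
      ≡ X * invℕ (suc M !) * (fromℕ (suc M C l) * ((- 1#) ^ (suc M ∸ l) * shifted X l ^ M))
  kernel-term X M zero _ = begin
    kernel z 0 * expLin (- z) (suc M)
      ≡⟨ cong₂ _*_ (trans (1+qt-⊛-zero (expLin z)) (cong (1# *_) invℕ-1)) (cong (λ w → - z * w * invℕ (suc M !)) (-x^n≡[-1]^n*x^n z M)) ⟩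
    1# * 1# * (- z * ((- 1#) ^ M * z ^ M) * invℕ (suc M !))
      ≡⟨ solve 5 (λ X q i s w → con (ℤ.+ 1) :* con (ℤ.+ 1) :* (:- (X :+ :- (q :* con (ℤ.+ 0))) :* (s :* w) :* i)
                                := X :* i :* ((con (ℤ.+ 1) :+ con (ℤ.+ 0)) :* (:- con (ℤ.+ 1) :* s :* w)))
               refl X q (invℕ (suc M !)) ((- 1#) ^ M) (z ^ M) ⟩
    X * invℕ (suc M !) * (fromℕ (suc M C 0) * ((- 1#) ^ suc M * z ^ M))
      ∎
    where
    open ≡-Reasoning
    z = shifted X 0
  kernel-term X M (suc m) (s≤s m≤M) = begin
    kernel z (suc m) * expLin (- z) (M ∸ m)
      ≡⟨ cong₂ _*_ (1+qt-⊛-suc (expLin z) m) (cong (_* ib) (-x^n≡[-1]^n*x^n z (M ∸ m))) ⟩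
    (z * a * ia + q * (a * invℕ (m !))) * (s * b * ib)
      ≡⟨ cong (λ w → (z * a * ia + q * (a * w)) * (s * b * ib)) (fromℕ-suc*invℕ-suc! m) ⟨
    (z * a * ia + q * (a * (u * ia))) * (s * b * ib)
      ≡⟨ solve 8 (λ X q u a b ia ib s → ((X :+ :- (q :* u)) :* a :* ia :+ q :* (a :* (u :* ia))) :* (s :* b :* ib)
                                       := X :* (ia :* ib) :* (s :* (a :* b)))
               refl X q u a b ia ib s ⟩
    X * (ia * ib) * (s * (a * b))
      ≡⟨ cong₂ (λ c w → X * c * (s * w)) (fromℕ-C*invℕ-! (s≤s m≤M)) (trans (cong (z ^_) (sym (ℕₚ.m+[n∸m]≡n m≤M))) (^-+ z m (M ∸ m))) ⟨
    X * (fromℕ (suc M C suc m) * invℕ (suc M !)) * (s * z ^ M)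
      ≡⟨ solve 4 (λ X c i w → X :* (c :* i) :* w := X :* i :* (c :* w)) refl X _ _ _ ⟩
    X * invℕ (suc M !) * (fromℕ (suc M C suc m) * (s * z ^ M))
      ∎
    where
    open ≡-Reasoning
    u = fromℕ (suc m)
    z = shifted X (suc m)
    a = z ^ m
    b = z ^ (M ∸ m)
    ia = invℕ (suc m !)
    ib = invℕ ((M ∸ m) !)
    s = (- 1#) ^ (M ∸ m)

  abel-kernel : ∀ X N → sumTo N (λ l → kernel (shifted X l) l * expLin (- shifted X l) (N ∸ l)) ≡ onePS N
  abel-kernel X zero = begin
    kernel (shifted X 0) 0 * expLin (- shifted X 0) 0   ≡⟨ cong₂ _*_ (trans (1+qt-⊛-zero (expLin (shifted X 0))) (cong (1# *_) invℕ-1)) (cong (1# *_) invℕ-1) ⟩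
    1# * 1# * (1# * 1#)                                 ≡⟨ solve 0 (con (ℤ.+ 1) :* con (ℤ.+ 1) :* (con (ℤ.+ 1) :* con (ℤ.+ 1)) := con (ℤ.+ 1)) refl ⟩
    1#                                                  ∎
    where open ≡-Reasoning
  abel-kernel X (suc M) = begin
    sumTo (suc M) (λ l → kernel (shifted X l) l * expLin (- shifted X l) (suc M ∸ l))
      ≡⟨ sumTo-cong-≤ (suc M) (kernel-term X M) ⟩
    sumTo (suc M) (λ l → X * invℕ (suc M !) * (fromℕ (suc M C l) * ((- 1#) ^ (suc M ∸ l) * shifted X l ^ M)))
      ≡⟨ *-distribˡ-sumTo (suc M) _ _ ⟨
    X * invℕ (suc M !) * Δ (suc M) (λ l → shifted X l ^ M)
      ≡⟨ cong (X * invℕ (suc M !) *_) (trans (Δ-cong (suc M) expand) (Δ-polynomial-vanishes (suc M) M b (ℕₚ.n<1+n M))) ⟩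
    X * invℕ (suc M !) * 0#
      ≡⟨ zeroʳ _ ⟩
    0#
      ∎
    where
    open ≡-Reasoning
    b : ℕ → R
    b j = fromℕ (M C j) * (X ^ (M ∸ j) * (- q) ^ j)
    expand : ∀ l → shifted X l ^ M ≡ sumTo M (λ j → b j * fromℕ l ^ j)
    expand l = begin
      (X - q * fromℕ l) ^ M
        ≡⟨ cong (_^ M) (solve 3 (λ X q u → X :+ :- (q :* u) := u :* :- q :+ X) refl X q (fromℕ l)) ⟩
      (fromℕ l * - q + X) ^ M
        ≡⟨ binomial-theorem _ _ M ⟩
      sumTo M (λ j → fromℕ (M C j) * ((fromℕ l * - q) ^ j * X ^ (M ∸ j)))
        ≡⟨ sumTo-cong M (λ j → trans (cong (λ z → fromℕ (M C j) * (z * X ^ (M ∸ j))) (^-* (fromℕ l) (- q) j))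
                                     (solve 4 (λ c a b x → c :* (a :* b :* x) := c :* (x :* b) :* a) refl _ _ _ _)) ⟩
      sumTo M (λ j → b j * fromℕ l ^ j)
        ∎

  shifted-+ : ∀ X i l → shifted X (i ℕ.+ l) ≡ shifted (shifted X i) l
  shifted-+ X i l = trans (cong (λ z → X - q * z) (fromℕ-+ i l))
    (solve 4 (λ X q a b → X :+ :- (q :* (a :+ b)) := X :+ :- (q :* a) :+ :- (q :* b)) refl X q (fromℕ i) (fromℕ l))

  kernel-factor : ∀ (A : PS) z → 1+qt ⊛ (A ⊛ expLin z) ≗ A ⊛ kernel z
  kernel-factor A z k = begin
    (1+qt ⊛ (A ⊛ expLin z)) k   ≡⟨ ⊛-comm 1+qt (A ⊛ expLin z) k ⟩
    ((A ⊛ expLin z) ⊛ 1+qt) k   ≡⟨ ⊛-assoc A (expLin z) 1+qt k ⟩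
    (A ⊛ (expLin z ⊛ 1+qt)) k   ≡⟨ ⊛-cong {g′ = kernel z} (λ _ → refl) (⊛-comm (expLin z) 1+qt) k ⟩
    (A ⊛ kernel z) k            ∎
    where open ≡-Reasoning

  abel-inversion : ∀ (A : PS) X N →
    sumTo N (λ k → (1+qt ⊛ (A ⊛ expLin (shifted X k))) k * expLin (- shifted X k) (N ∸ k)) ≡ A N
  abel-inversion A X N = begin
    sumTo N (λ k → (1+qt ⊛ (A ⊛ expLin (shifted X k))) k * expLin (- shifted X k) (N ∸ k))
      ≡⟨ sumTo-cong N (λ k → trans (cong (_* expLin (- shifted X k) (N ∸ k)) (kernel-factor A (shifted X k) k)) (*-distribʳ-sumTo k _ _)) ⟩
    sumTo N (λ k → sumTo k (λ i → A i * kernel (shifted X k) (k ∸ i) * expLin (- shifted X k) (N ∸ k)))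
      ≡⟨ sumTo-cong N (λ k → sumTo-cong-≤ k (λ i i≤k → trans (cong (λ m → F′ i m (k ∸ i)) (ℕₚ.m+[n∸m]≡n i≤k)) (sym (*-assoc _ _ _)))) ⟨
    sumTo N (λ k → sumTo k (λ i → F i (k ∸ i)))
      ≡⟨ sumTo-antidiagonal N F ⟩
    sumTo N (λ i → sumTo (N ∸ i) (F i))
      ≡⟨ sumTo-cong N (λ i → *-distribˡ-sumTo (N ∸ i) (A i) _) ⟨
    sumTo N (λ i → A i * sumTo (N ∸ i) (λ l → kernel (shifted X (i ℕ.+ l)) l * expLin (- shifted X (i ℕ.+ l)) (N ∸ (i ℕ.+ l))))
      ≡⟨ sumTo-cong N (λ i → cong (A i *_) (trans (sumTo-cong (N ∸ i) (λ l → cong₂ (λ z w → kernel z l * expLin (- z) w)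
                                 (shifted-+ X i l) (sym (ℕₚ.∸-+-assoc N i l)))) (abel-kernel (shifted X i) (N ∸ i)))) ⟩
    sumTo N (λ i → A i * onePS (N ∸ i))
      ≡⟨ ⊛-identityʳ A N ⟩
    A N
      ∎
    where
    open ≡-Reasoning
    F′ : ℕ → ℕ → ℕ → R
    F′ i k l = A i * (kernel (shifted X k) l * expLin (- shifted X k) (N ∸ k))
    F : ℕ → ℕ → R
    F i l = F′ i (i ℕ.+ l) l

module AbelConvolution (ℝ : RealField) (q : RealField.R ℝ) where
  open RealField ℝ
  open RealDefs ℝ
  open RingOfReals ℝ
  open FiniteSums ℝ
  open NaturalEmbedding ℝ
  open PowerSeries ℝ
  open AbelKernel ℝ q

  expLin-shift : ∀ x y k → expLin (y + q * fromℕ k) ≗ expLin (x + y) ⊛ expLin (- shifted x k)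
  expLin-shift x y k = subst (λ z → expLin z ≗ expLin (x + y) ⊛ expLin (- shifted x k))
    (solve 3 (λ x y w → x :+ y :+ :- (x :+ :- w) := y :+ w) refl x y (q * fromℕ k))
    (expLin-+ (x + y) (- shifted x k))

  abel-convolution : ∀ (A B : PS) x y n →
    ((A ⊛ B) ⊛ expLin (x + y)) n
      ≡ sumTo n (λ k → (1+qt ⊛ (A ⊛ expLin (shifted x k))) k * (B ⊛ expLin (y + q * fromℕ k)) (n ∸ k))
  abel-convolution A B x y n = sym (begin
    sumTo n (λ k → U k * (B ⊛ expLin (y + q * fromℕ k)) (n ∸ k))
      ≡⟨ sumTo-cong n (λ k → trans (cong (U k *_) (shift k (n ∸ k))) (*-distribˡ-sumTo (n ∸ k) _ _)) ⟩
    sumTo n (λ k → sumTo (n ∸ k) (λ r → U k * (S r * E k (n ∸ k ∸ r))))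
      ≡⟨ sumTo-triangle-comm n (λ k r → U k * (S r * E k (n ∸ k ∸ r))) ⟩
    sumTo n (λ r → sumTo (n ∸ r) (λ k → U k * (S r * E k (n ∸ k ∸ r))))
      ≡⟨ sumTo-cong n (λ r → trans (sumTo-cong (n ∸ r) (λ k → reorder k r)) (sym (*-distribˡ-sumTo (n ∸ r) _ _))) ⟩
    sumTo n (λ r → S r * sumTo (n ∸ r) (λ k → U k * E k (n ∸ r ∸ k)))
      ≡⟨ sumTo-cong n (λ r → cong (S r *_) (abel-inversion A x (n ∸ r))) ⟩
    (S ⊛ A) n
      ≡⟨ ⊛-comm S A n ⟩
    (A ⊛ (B ⊛ expLin (x + y))) n
      ≡⟨ ⊛-assoc A B (expLin (x + y)) n ⟨
    ((A ⊛ B) ⊛ expLin (x + y)) n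
      ∎)
    where
    open ≡-Reasoning
    U : ℕ → R
    U k = (1+qt ⊛ (A ⊛ expLin (shifted x k))) k
    S : PS
    S = B ⊛ expLin (x + y)
    E : ℕ → PS
    E k = expLin (- shifted x k)
    shift : ∀ k → B ⊛ expLin (y + q * fromℕ k) ≗ S ⊛ E k
    shift k m = trans (⊛-cong {g′ = expLin (x + y) ⊛ E k} (λ _ → refl) (expLin-shift x y k) m)
                      (sym (⊛-assoc B (expLin (x + y)) (E k) m))
    reorder : ∀ k r → U k * (S r * E k (n ∸ k ∸ r)) ≡ S r * (U k * E k (n ∸ r ∸ k))
    reorder k r = trans (cong (λ m → U k * (S r * E k m)) (ℕₚ.∸-+-assoc n k r))
      (trans (cong (λ m → U k * (S r * E k (n ∸ m))) (ℕₚ.+-comm k r))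
      (trans (cong (λ m → U k * (S r * E k m)) (sym (ℕₚ.∸-+-assoc n r k)))
             (solve 3 (λ u c e → u :* (c :* e) := c :* (u :* e)) refl _ _ _)))

  bracket-coefficient : ∀ a α x k →
    bracket a α q x k ≡ fromℕ (k !) * (1+qt ⊛ (powαPS (egf a) α ⊛ expLin (shifted x k))) k
  bracket-coefficient a α x zero    = cong (fromℕ 1 *_) (sym (1+qt-⊛-zero (A ⊛ expLin (shifted x 0))))
    where A = powαPS (egf a) α
  bracket-coefficient a α x (suc j) = begin
    fromℕ (suc j !) * c (suc j) + q * fromℕ (suc j) * (fromℕ (j !) * c j)
      ≡⟨ cong (λ z → z * c (suc j) + q * fromℕ (suc j) * (fromℕ (j !) * c j)) (fromℕ-* (suc j) (j !)) ⟩
    fromℕ (suc j) * fromℕ (j !) * c (suc j) + q * fromℕ (suc j) * (fromℕ (j !) * c j)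
      ≡⟨ solve 5 (λ u f a b q → u :* f :* a :+ q :* u :* (f :* b) := u :* f :* (a :+ q :* b)) refl _ _ _ _ _ ⟩
    fromℕ (suc j) * fromℕ (j !) * (c (suc j) + q * c j)
      ≡⟨ cong₂ _*_ (sym (fromℕ-* (suc j) (j !))) (sym (1+qt-⊛-suc c j)) ⟩
    fromℕ (suc j !) * (1+qt ⊛ c) (suc j)
      ∎
    where
    open ≡-Reasoning
    c = powαPS (egf a) α ⊛ expLin (shifted x (suc j))

corollary7 : (ℝ : RealField) → let open RealField ℝ in let open RealDefs ℝ in
    (a : ℕ → R) → a 0 ≡ 1# →
    (α β q x y : R) (n : ℕ) →
      fpoly a (α + β) n (x + y) ≡
        sumTo n (λ k → fromℕ (n C k) * bracket a α q x k * fpoly a β (n ∸ k) (y + q * fromℕ k))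
corollary7 ℝ a _ α β q x y n = begin
  fromℕ (n !) * (F^ (α + β) ⊛ expLin (x + y)) n
    ≡⟨ cong (fromℕ (n !) *_) (⊛-cong {g′ = expLin (x + y)} (expPS-·-+ α β) (λ _ → refl) n) ⟩
  fromℕ (n !) * ((F^ α ⊛ F^ β) ⊛ expLin (x + y)) n
    ≡⟨ cong (fromℕ (n !) *_) (abel-convolution (F^ α) (F^ β) x y n) ⟩
  fromℕ (n !) * sumTo n (λ k → U k * V k (n ∸ k))
    ≡⟨ fromℕ-!-*-sumTo n U (λ k → V k (n ∸ k)) ⟩
  sumTo n (λ k → fromℕ (n C k) * (fromℕ (k !) * U k) * (fromℕ ((n ∸ k) !) * V k (n ∸ k)))
    ≡⟨ sumTo-cong n (λ k → cong (λ b → fromℕ (n C k) * b * fpoly a β (n ∸ k) (y + q * fromℕ k))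
                                (sym (bracket-coefficient a α x k))) ⟩
  sumTo n (λ k → fromℕ (n C k) * bracket a α q x k * fpoly a β (n ∸ k) (y + q * fromℕ k))
    ∎
  where
  open RealField ℝ
  open RealDefs ℝ
  open FiniteSums ℝ
  open FactorialInverses ℝ
  open PowerSeries ℝ
  open ExponentialLaw ℝ (logPS (egf a)) (logPS-constant (egf a))
  open AbelKernel ℝ q
  open AbelConvolution ℝ q
  open ≡-Reasoning
  F^ : R → PS
  F^ = powαPS (egf a)
  U : ℕ → R
  U k = (1+qt ⊛ (F^ α ⊛ expLin (shifted x k))) k
  V : ℕ → PS
  V k = F^ β ⊛ expLin (y + q * fromℕ k)
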